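{- For every $n\ge 2$, the map sending an $n\times n$ alternating sign matrix $A$ with height function $h$ to the array \[ \delta_{ij}=\tfrac12\bigl(h_{ij}-h^{(0)}_{ij}\bigr),\qquad 1\le i,j\le n-1, \] is a bijection from the set of $n\times n$ alternating sign matrices onto the set of Dyck islands of size $n$. Consequently, Dyck islands of size $n$ are in bijection with $n\times n$ alternating sign matrices, and hence with fully packed loops of size $n$.
   Context: An alternating sign matrix (ASM) of size $n$ is an $n\times n$ matrix with entries in $\{0,1,-1\}$ such that every row and column sums to $1$ and nonzero entries alternate in sign along each row and column. Its height function is $h_{ij}=i+j-2\sum_{i'\le i,\,j'\le j}A_{i'j'}$, $0\le i,j\le n$ (empty sums are $0$). $h^{(0)}$ denotes the height function of the identity matrix, $h^{(0)}_{ij}=|i-j|$. A Dyck island of size $n$ is an $(n-1)\times(n-1)$ array $(\delta_{ij})_{1\le i,j\le n-1}$ of nonnegative integers satisfying: (i) $\delta_{ij}\ge\delta_{i'j'}$ whenever $i\ge j$, $i\le i'$ and $j\ge j'$; (ii) $\delta_{ij}\ge\delta_{i'j'}$ whenever $i\le j$, $i\ge i'$ and $j\le j'$; (iii) $\delta_{ij}\in\{0,1\}$ whenever $i,j\in\{1,n-1\}$; (iv) $|\delta_{ij}-\delta_{(i+1)j}|\le1$ and $|\delta_{ij}-\delta_{i(j+1)}|\le 1$ whenever the indices are in range. Fully packed loops of size $n$ are in a well-known bijection with $n\times n$ ASMs. -}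

module Defs where

open import Data.Nat as ℕ using (ℕ; zero; suc; _≤_; _<_; _<ᵇ_; _∸_; ∣_-_∣)
open import Data.Integer as ℤ using (ℤ; +_; -_; _+_; _-_; _*_)
open import Data.Fin using (Fin; toℕ; zero; suc)
open import Data.Bool using (if_then_else_)
open import Data.Product using (Σ; ∃; _×_; proj₁)
open import Data.Sum using (_⊎_)
open import Relation.Binary.PropositionalEquality using (_≡_; _≢_)

sumFin : {n : ℕ} → (Fin n → ℤ) → ℤ
sumFin {zero}  f = + 0
sumFin {suc n} f = f zero + sumFin (λ a → f (suc a))

-- n×n integer matrices; the entry in (1-based) row toℕ a + 1, column toℕ b + 1.
Matrix : ℕ → Set
Matrix n = Fin n → Fin n → ℤ

record IsASM (n : ℕ) (M : Matrix n) : Set where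
  field
    entries  : ∀ a b → M a b ≡ + 0 ⊎ (M a b ≡ + 1 ⊎ M a b ≡ - (+ 1))
    rowSum   : ∀ a → sumFin (λ b → M a b) ≡ + 1
    colSum   : ∀ b → sumFin (λ a → M a b) ≡ + 1
    rowAlt   : ∀ a b b' → toℕ b < toℕ b' → M a b ≢ + 0 → M a b' ≢ + 0 →
               (∀ c → toℕ b < toℕ c → toℕ c < toℕ b' → M a c ≡ + 0) →
               M a b' ≡ - M a b
    colAlt   : ∀ b a a' → toℕ a < toℕ a' → M a b ≢ + 0 → M a' b ≢ + 0 →
               (∀ c → toℕ a < toℕ c → toℕ c < toℕ a' → M c b ≡ + 0) →
               M a' b ≡ - M a b

ASM : ℕ → Set
ASM n = Σ (Matrix n) (IsASM n)

-- Σ_{i' ≤ i, j' ≤ j} A_{i'j'} (1-based indices i', j'; i, j ∈ {0..n}).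
cornerSum : {n : ℕ} → Matrix n → ℕ → ℕ → ℤ
cornerSum M i j =
  sumFin (λ a → if toℕ a <ᵇ i
                then sumFin (λ b → if toℕ b <ᵇ j then M a b else + 0)
                else + 0)

height : {n : ℕ} → Matrix n → ℕ → ℕ → ℤ
height M i j = + i + + j - + 2 * cornerSum M i j

-- Height function of the identity matrix: h⁽⁰⁾_{ij} = |i - j|.
height0 : ℕ → ℕ → ℤ
height0 i j = + ∣ i - j ∣

-- (n-1)×(n-1) arrays of nonnegative integers; index d : Fin (n ∸ 1)
-- stands for the 1-based index toℕ d + 1.
Array : ℕ → Set
Array n = Fin (n ∸ 1) → Fin (n ∸ 1) → ℕ

ix : {k : ℕ} → Fin k → ℕ
ix d = suc (toℕ d)

record IsDyckIsland (n : ℕ) (δ : Array n) : Set where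
  field
    cond-i   : ∀ i j i' j' → ix j ≤ ix i → ix i ≤ ix i' → ix j' ≤ ix j →
               δ i' j' ≤ δ i j
    cond-ii  : ∀ i j i' j' → ix i ≤ ix j → ix i' ≤ ix i → ix j ≤ ix j' →
               δ i' j' ≤ δ i j
    cond-iii : ∀ i j → (ix i ≡ 1 ⊎ ix i ≡ n ∸ 1) → (ix j ≡ 1 ⊎ ix j ≡ n ∸ 1) →
               δ i j ≤ 1
    cond-ivr : ∀ i i' j → ix i' ≡ suc (ix i) → ∣ δ i j - δ i' j ∣ ≤ 1
    cond-ivc : ∀ i j j' → ix j' ≡ suc (ix j) → ∣ δ i j - δ i j' ∣ ≤ 1

DyckIsland : ℕ → Set
DyckIsland n = Σ (Array n) (IsDyckIsland n)

IsHalfHeightDiff : (n : ℕ) → Matrix n → Array n → Set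
IsHalfHeightDiff n M δ =
  ∀ i j → + 2 * + (δ i j) ≡ height M (ix i) (ix j) - height0 (ix i) (ix j)

module Submission where

open import Defs
open import Data.Nat using (ℕ; _≤_)
open import Data.Product using (Σ; ∃; _×_; proj₁)
open import Relation.Binary.PropositionalEquality using (_≡_)

open import Data.Nat as ℕ using (zero; suc; _<_; _<ᵇ_; _∸_; ∣_-_∣; _⊓_; z≤n; s≤s)
import Data.Nat.Properties as ℕP
open import Data.Integer as ℤ using (ℤ; +_; -_; _+_; _-_; _*_)
import Data.Integer.Properties as ℤP
open import Data.Integer.Tactic.RingSolver using (solve-∀)
open import Data.Fin using (Fin; toℕ; zero; suc; fromℕ<)
open import Data.Fin.Properties using (toℕ-fromℕ<; toℕ<n)
open import Data.Bool using (if_then_else_)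
open import Data.Product using (_,_; proj₂)
open import Data.Sum using (_⊎_; inj₁; inj₂)
open import Data.Empty using (⊥; ⊥-elim)
open import Relation.Nullary using (yes; no)
open import Relation.Binary.PropositionalEquality
  using (_≢_; refl; sym; trans; cong; cong₂; subst; subst₂; module ≡-Reasoning)

-- For a matrix A let c(i,j) = Σ_{i'≤i, j'≤j} A_{i'j'} be its corner sums; the
-- height function is h = i + j - 2c, so δ = (h - h⁽⁰⁾)/2 = min(i,j) - c(i,j).
-- For an ASM every partial row or column sum is 0 or 1 (AlternatingSequence),
-- hence c is a "corner profile": a natural-number function vanishing on the
-- top and left border, with c(n,n) = n, nondecreasing with steps of at most 1
-- in each variable (CornerProfile).  Every corner profile yields a Dyck island
-- (ProfileIsland); this is the forward map.  It is injective since A is the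
-- second difference of c, and c is fixed by δ inside the grid and by the row
-- and column sums on its border (Injectivity).  Conversely a Dyck island,
-- padded with zeros, defines c = min(i,j) - δ whose row and column increments
-- are 0 or 1 (IslandCorner); differences of a 0/1 sequence alternate in sign
-- (BitDifferences), so the second difference of c is an ASM mapped to the
-- island (FromIsland).
--
-- Sums over Fin n are turned into prefix sums of ℕ-indexed functions (`at`,
-- `psum`), so that all counting arguments are inductions on ℕ.

at : {A : Set} → A → (n : ℕ) → ℕ → (Fin n → A) → A
at d zero    k       f = d
at d (suc n) zero    f = f zero
at d (suc n) (suc k) f = at d n k (λ x → f (suc x))

atℤ : (n : ℕ) → ℕ → (Fin n → ℤ) → ℤ
atℤ = at (+ 0)

at-toℕ : {A : Set} (d : A) (n : ℕ) (x : Fin n) (f : Fin n → A) → at d n (toℕ x) f ≡ f x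
at-toℕ d (suc n) zero    f = refl
at-toℕ d (suc n) (suc x) f = at-toℕ d n x (λ y → f (suc y))

at-fromℕ< : {A : Set} (d : A) (n k : ℕ) (p : k < n) (f : Fin n → A) → at d n k f ≡ f (fromℕ< p)
at-fromℕ< d (suc n) zero    p       f = refl
at-fromℕ< d (suc n) (suc k) (s≤s p) f = at-fromℕ< d n k p (λ y → f (suc y))

at-out : {A : Set} (d : A) (n k : ℕ) → n ≤ k → (f : Fin n → A) → at d n k f ≡ d
at-out d zero    k       p       f = refl
at-out d (suc n) (suc k) (s≤s p) f = at-out d n k p (λ y → f (suc y))

at-all : {A : Set} (P : A → Set) (d : A) (n k : ℕ) (f : Fin n → A) →
  P d → (∀ x → P (f x)) → P (at d n k f)
at-all P d zero    k       f pd pf = pd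
at-all P d (suc n) zero    f pd pf = pf zero
at-all P d (suc n) (suc k) f pd pf = at-all P d n k (λ y → f (suc y)) pd (λ y → pf (suc y))

at-cong : {A : Set} (d : A) (n k : ℕ) (f g : Fin n → A) → (∀ x → f x ≡ g x) → at d n k f ≡ at d n k g
at-cong d zero    k       f g e = refl
at-cong d (suc n) zero    f g e = e zero
at-cong d (suc n) (suc k) f g e = at-cong d n k _ _ (λ y → e (suc y))

at-fun : {A : Set} (d : A) (n k : ℕ) (F : ℕ → A) → k < n → at d n k (λ x → F (toℕ x)) ≡ F k
at-fun d (suc n) zero    F p       = refl
at-fun d (suc n) (suc k) F (s≤s p) = at-fun d n k (λ i → F (suc i)) p

at-const : {A : Set} (d : A) (n k : ℕ) → at d n k (λ _ → d) ≡ d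
at-const d n k = at-all (λ v → v ≡ d) d n k (λ _ → d) refl (λ _ → refl)

at-swap : {A : Set} (d : A) (n m a b : ℕ) (F : Fin n → Fin m → A) →
  at d n a (λ x → at d m b (F x)) ≡ at d m b (λ y → at d n a (λ x → F x y))
at-swap d zero    m a       b F = sym (at-const d m b)
at-swap d (suc n) m zero    b F = refl
at-swap d (suc n) m (suc a) b F = at-swap d n m a b (λ x → F (suc x))

psum : (ℕ → ℤ) → ℕ → ℤ
psum g zero    = + 0
psum g (suc k) = psum g k + g k

psumℕ : (ℕ → ℕ) → ℕ → ℕ
psumℕ g zero    = 0
psumℕ g (suc k) = psumℕ g k ℕ.+ g k

psum-cong : (g h : ℕ → ℤ) (j : ℕ) → (∀ k → k < j → g k ≡ h k) → psum g j ≡ psum h j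
psum-cong g h zero    e = refl
psum-cong g h (suc j) e = cong₂ _+_ (psum-cong g h j (λ k p → e k (ℕP.m≤n⇒m≤1+n p))) (e j ℕP.≤-refl)

psum-zero : (g : ℕ → ℤ) (j : ℕ) → (∀ k → g k ≡ + 0) → psum g j ≡ + 0
psum-zero g zero    e = refl
psum-zero g (suc j) e rewrite psum-zero g j e | e j = refl

psum-shift : (g : ℕ → ℤ) (k : ℕ) → psum g (suc k) ≡ g 0 + psum (λ i → g (suc i)) k
psum-shift g zero    = trans (ℤP.+-identityˡ (g 0)) (sym (ℤP.+-identityʳ (g 0)))
psum-shift g (suc k) rewrite psum-shift g k = ℤP.+-assoc (g 0) _ _

psum-+ : (f g : ℕ → ℤ) (j : ℕ) → psum (λ k → f k + g k) j ≡ psum f j + psum g j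
psum-+ f g zero    = refl
psum-+ f g (suc j) rewrite psum-+ f g j = interchange (psum f j) (psum g j) (f j) (g j)
  where
    interchange : ∀ a b c d → a + b + (c + d) ≡ a + c + (b + d)
    interchange = solve-∀

psum-swap : (h : ℕ → ℕ → ℤ) (i j : ℕ) →
  psum (λ a → psum (h a) j) i ≡ psum (λ b → psum (λ a → h a b) i) j
psum-swap h zero    j = sym (psum-zero _ j (λ _ → refl))
psum-swap h (suc i) j rewrite psum-swap h i j = sym (psum-+ (λ b → psum (λ a → h a b) i) (h i) j)

psum-telescope : (F : ℕ → ℤ) (j : ℕ) → psum (λ k → F (suc k) - F k) j ≡ F j - F 0
psum-telescope F zero    = sym (ℤP.+-inverseʳ (F 0))
psum-telescope F (suc j) rewrite psum-telescope F j = step (F j) (F 0) (F (suc j))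
  where
    step : ∀ a b c → a - b + (c - a) ≡ c - b
    step = solve-∀

psumℕ-psum : (f : ℕ → ℕ) (j : ℕ) → + psumℕ f j ≡ psum (λ k → + f k) j
psumℕ-psum f zero    = refl
psumℕ-psum f (suc j) rewrite sym (psumℕ-psum f j) = ℤP.pos-+ (psumℕ f j) (f j)

psumℕ-ones : (n : ℕ) (f : ℕ → ℕ) → (∀ a → a < n → f a ≡ 1) → ∀ i → i ≤ n → psumℕ f i ≡ i
psumℕ-ones n f e zero    p = refl
psumℕ-ones n f e (suc i) p rewrite psumℕ-ones n f e i (ℕP.<⇒≤ p) | e i p = ℕP.+-comm i 1

psum-beyond : (g : ℕ → ℤ) (n t : ℕ) → (∀ k → n ≤ k → g k ≡ + 0) → psum g (n ℕ.+ t) ≡ psum g n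
psum-beyond g n zero    e rewrite ℕP.+-identityʳ n = refl
psum-beyond g n (suc t) e rewrite ℕP.+-suc n t | psum-beyond g n t e | e (n ℕ.+ t) (ℕP.m≤m+n n t) =
  ℤP.+-identityʳ _

sumFin≡psum : (n : ℕ) (G G' : Fin n → ℤ) → (∀ a → G a ≡ G' a) → sumFin G ≡ psum (λ k → atℤ n k G') n
sumFin≡psum zero    G G' e = refl
sumFin≡psum (suc n) G G' e rewrite psum-shift (λ k → atℤ (suc n) k G') n =
  cong₂ _+_ (e zero) (sumFin≡psum n (λ a → G (suc a)) (λ a → G' (suc a)) (λ a → e (suc a)))

sumFin-zero : (n : ℕ) (G : Fin n → ℤ) → (∀ a → G a ≡ + 0) → sumFin G ≡ + 0
sumFin-zero zero    G e = refl
sumFin-zero (suc n) G e rewrite e zero | sumFin-zero n (λ a → G (suc a)) (λ a → e (suc a)) = refl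

sumFin-below : (n i : ℕ) (G G' : Fin n → ℤ) → (∀ a → G a ≡ G' a) →
  sumFin (λ a → if toℕ a <ᵇ i then G a else + 0) ≡ psum (λ k → atℤ n k G') i
sumFin-below zero    i       G G' e = sym (psum-zero _ i (λ _ → refl))
sumFin-below (suc n) zero    G G' e = sumFin-zero (suc n) _ (λ a → nothing-below (toℕ a) (G a))
  where
    nothing-below : ∀ k v → (if k <ᵇ 0 then v else + 0) ≡ + 0
    nothing-below zero    v = refl
    nothing-below (suc k) v = refl
sumFin-below (suc n) (suc i) G G' e rewrite psum-shift (λ k → atℤ (suc n) k G') i =
  cong₂ _+_ (e zero) (sumFin-below n i (λ a → G (suc a)) (λ a → G' (suc a)) (λ a → e (suc a)))

at-psum : (n a j : ℕ) (φ : Fin n → ℕ → ℤ) →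
  atℤ n a (λ x → psum (φ x) j) ≡ psum (λ b → atℤ n a (λ x → φ x b)) j
at-psum zero    a       j φ = sym (psum-zero _ j (λ _ → refl))
at-psum (suc n) zero    j φ = refl
at-psum (suc n) (suc a) j φ = at-psum n a j (λ x → φ (suc x))

Sign : ℤ → Set
Sign v = v ≡ + 0 ⊎ (v ≡ + 1 ⊎ v ≡ - (+ 1))

Bit : ℤ → Set
Bit v = v ≡ + 0 ⊎ v ≡ + 1

-- Every partial sum is 0 or equals the last
-- nonzero entry so far; were one of them -1, all later partial sums would stay
-- in {-1,0}, contradicting the total 1.
module AlternatingSequence (n : ℕ) (f : Fin n → ℤ)
  (sign : ∀ x → Sign (f x))
  (total : sumFin f ≡ + 1)
  (alternates : ∀ b b' → toℕ b < toℕ b' → f b ≢ + 0 → f b' ≢ + 0 →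
     (∀ c → toℕ b < toℕ c → toℕ c < toℕ b' → f c ≡ + 0) → f b' ≡ - f b) where

  g : ℕ → ℤ
  g k = atℤ n k f

  g-sign : ∀ k → Sign (g k)
  g-sign k = at-all Sign (+ 0) n k f (inj₁ refl) sign

  g-out : ∀ k → n ≤ k → g k ≡ + 0
  g-out k p = at-out (+ 0) n k p f

  g-alternates : ∀ k k' → k < k' → g k ≢ + 0 → g k' ≢ + 0 →
    (∀ c → k < c → c < k' → g c ≡ + 0) → g k' ≡ - g k
  g-alternates k k' k<k' nz nz' between with ℕP.<-≤-connex k' n
  ... | inj₂ n≤k' = ⊥-elim (nz' (g-out k' n≤k'))
  ... | inj₁ k'<n = trans e' (trans alt (cong -_ (sym e)))
    where
      k<n : k < n
      k<n = ℕP.<-trans k<k' k'<n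
      e : g k ≡ f (fromℕ< k<n)
      e = at-fromℕ< (+ 0) n k k<n f
      e' : g k' ≡ f (fromℕ< k'<n)
      e' = at-fromℕ< (+ 0) n k' k'<n f
      alt : f (fromℕ< k'<n) ≡ - f (fromℕ< k<n)
      alt = alternates (fromℕ< k<n) (fromℕ< k'<n)
              (subst₂ _<_ (sym (toℕ-fromℕ< k<n)) (sym (toℕ-fromℕ< k'<n)) k<k')
              (λ q → nz (trans e q)) (λ q → nz' (trans e' q))
              (λ c p q → trans (sym (at-toℕ (+ 0) n c f))
                 (between (toℕ c) (subst (_< toℕ c) (toℕ-fromℕ< k<n) p)
                                  (subst (toℕ c <_) (toℕ-fromℕ< k'<n) q)))

  g-total : ∀ t → psum g (t ℕ.+ n) ≡ + 1
  g-total t = trans (cong (psum g) (ℕP.+-comm t n))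
    (trans (psum-beyond g n t g-out) (trans (sym (sumFin≡psum n f f (λ _ → refl))) total))

  LastNonzero : ℕ → ℕ → Set
  LastNonzero j k = k < j × g k ≢ + 0 × (∀ c → k < c → c < j → g c ≡ + 0)

  lastNonzero-skip : ∀ j k → LastNonzero j k → g j ≡ + 0 → LastNonzero (suc j) k
  lastNonzero-skip j k (k<j , nz , between) gj≡0 =
    ℕP.m≤n⇒m≤1+n k<j , nz , λ c k<c c<1+j → zero-at c (ℕP.m<1+n⇒m<n∨m≡n c<1+j) k<c
    where
      zero-at : ∀ c → c < j ⊎ c ≡ j → k < c → g c ≡ + 0
      zero-at c (inj₁ c<j)  k<c = between c k<c c<j
      zero-at c (inj₂ refl) _   = gj≡0

  lastNonzero-new : ∀ j → g j ≢ + 0 → LastNonzero (suc j) j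
  lastNonzero-new j nz = ℕP.≤-refl , nz , λ c j<c c<1+j → ⊥-elim (ℕP.<⇒≱ j<c (ℕP.m<1+n⇒m≤n c<1+j))

  partial-last : ∀ j → psum g j ≡ + 0 ⊎ Σ ℕ λ k → LastNonzero j k × psum g j ≡ g k
  partial-last zero = inj₁ refl
  partial-last (suc j) with g j ℤ.≟ + 0 | partial-last j
  ... | yes gj≡0 | inj₁ s≡0 = inj₁ (cong₂ _+_ s≡0 gj≡0)
  ... | yes gj≡0 | inj₂ (k , last , s≡gk) =
        inj₂ (k , lastNonzero-skip j k last gj≡0 ,
              trans (cong (λ v → psum g j + v) gj≡0) (trans (ℤP.+-identityʳ _) s≡gk))
  ... | no gj≢0  | inj₁ s≡0 =
        inj₂ (j , lastNonzero-new j gj≢0 , trans (cong (_+ g j) s≡0) (ℤP.+-identityˡ _))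
  ... | no gj≢0  | inj₂ (k , (k<j , gk≢0 , between) , s≡gk) =
        inj₁ (trans (cong₂ _+_ s≡gk (g-alternates k j k<j gk≢0 gj≢0 between)) (ℤP.+-inverseʳ (g k)))

  NegativePhase : ℕ → Set
  NegativePhase j = Σ ℕ λ k → LastNonzero j k ×
    ((psum g j ≡ - (+ 1) × g k ≡ - (+ 1)) ⊎ (psum g j ≡ + 0 × g k ≡ + 1))

  negativePhase-step : ∀ j → NegativePhase j → NegativePhase (suc j)
  negativePhase-step j (k , last , phase) with g j ℤ.≟ + 0
  ... | yes gj≡0 = k , lastNonzero-skip j k last gj≡0 , extend phase
    where
      extend : ((psum g j ≡ - (+ 1) × g k ≡ - (+ 1)) ⊎ (psum g j ≡ + 0 × g k ≡ + 1)) →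
               ((psum g (suc j) ≡ - (+ 1) × g k ≡ - (+ 1)) ⊎ (psum g (suc j) ≡ + 0 × g k ≡ + 1))
      extend (inj₁ (s , gk)) = inj₁ (cong₂ _+_ s gj≡0 , gk)
      extend (inj₂ (s , gk)) = inj₂ (cong₂ _+_ s gj≡0 , gk)
  ... | no gj≢0 with last
  ...   | (k<j , gk≢0 , between) with g-alternates k j k<j gk≢0 gj≢0 between | phase
  ...     | gj≡-gk | inj₁ (s , gk) =
            j , lastNonzero-new j gj≢0 , inj₂ (cong₂ _+_ s gj≡1 , gj≡1)
    where gj≡1 = trans gj≡-gk (cong -_ gk)
  ...     | gj≡-gk | inj₂ (s , gk) =
            j , lastNonzero-new j gj≢0 , inj₁ (cong₂ _+_ s gj≡-1 , gj≡-1)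
    where gj≡-1 = trans gj≡-gk (cong -_ gk)

  negativePhase-forever : ∀ j t → NegativePhase j → NegativePhase (j ℕ.+ t)
  negativePhase-forever j zero    ph rewrite ℕP.+-identityʳ j = ph
  negativePhase-forever j (suc t) ph rewrite ℕP.+-suc j t =
    negativePhase-step (j ℕ.+ t) (negativePhase-forever j t ph)

  negativePhase-not-final : ∀ j → NegativePhase (j ℕ.+ n) → ⊥
  negativePhase-not-final j (_ , _ , inj₁ (s , _)) with trans (sym s) (g-total j)
  ... | ()
  negativePhase-not-final j (_ , _ , inj₂ (s , _)) with trans (sym s) (g-total j)
  ... | ()

  partial-bit : ∀ j → Bit (psum g j)
  partial-bit j with partial-last j
  ... | inj₁ s≡0 = inj₁ s≡0
  ... | inj₂ (k , last , s≡gk) with g-sign k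
  ...   | inj₁ gk≡0         = ⊥-elim (proj₁ (proj₂ last) gk≡0)
  ...   | inj₂ (inj₁ gk≡1)  = inj₂ (trans s≡gk gk≡1)
  ...   | inj₂ (inj₂ gk≡-1) =
          ⊥-elim (negativePhase-not-final j
            (negativePhase-forever j n (k , last , inj₁ (trans s≡gk gk≡-1 , gk≡-1))))

rowPartial : {n : ℕ} → Matrix n → ℕ → ℕ → ℤ
rowPartial {n} M a j = atℤ n a (λ x → psum (λ b → atℤ n b (M x)) j)

colPartial : {n : ℕ} → Matrix n → ℕ → ℕ → ℤ
colPartial {n} M i b = atℤ n b (λ y → psum (λ a → atℤ n a (λ x → M x y)) i)

corner : {n : ℕ} → Matrix n → ℕ → ℕ → ℤ
corner M i j = psum (λ a → rowPartial M a j) i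

cornerSum≡corner : {n : ℕ} (M : Matrix n) (i j : ℕ) → cornerSum M i j ≡ corner M i j
cornerSum≡corner {n} M i j = sumFin-below n i _ _ (λ a → sumFin-below n j (M a) (M a) (λ _ → refl))

corner-by-columns : {n : ℕ} (M : Matrix n) (i j : ℕ) → corner M i j ≡ psum (λ b → colPartial M i b) j
corner-by-columns {n} M i j =
  trans (psum-cong _ _ i (λ a _ → at-psum n a j (λ x b → atℤ n b (M x))))
  (trans (psum-swap (λ a b → atℤ n a (λ x → atℤ n b (M x))) i j)
  (psum-cong _ _ j (λ b _ → trans (psum-cong _ _ i (λ a _ → at-swap (+ 0) n n a b M))
                                  (sym (at-psum n b i (λ y a → atℤ n a (λ x → M x y)))))))

-- Each entry is the second difference of the corner sums; this is what makes
-- a matrix recoverable from its height function.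
entry-second-difference : {n : ℕ} (M : Matrix n) (a b : Fin n) →
  M a b ≡ (corner M (suc (toℕ a)) (suc (toℕ b)) - corner M (toℕ a) (suc (toℕ b)))
        - (corner M (suc (toℕ a)) (toℕ b) - corner M (toℕ a) (toℕ b))
entry-second-difference {n} M a b = sym (begin
    (corner M (suc a') (suc b') - corner M a' (suc b')) - (corner M (suc a') b' - corner M a' b')
  ≡⟨ cancel-corners (corner M a' (suc b')) (corner M a' b') (rowPartial M a' (suc b')) (rowPartial M a' b') ⟩
    rowPartial M a' (suc b') - rowPartial M a' b'
  ≡⟨ cong₂ _-_ (at-toℕ (+ 0) n a _) (at-toℕ (+ 0) n a _) ⟩
    (psum row b' + row b') - psum row b'
  ≡⟨ cancel-prefix (psum row b') (row b') ⟩
    row b'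
  ≡⟨ at-toℕ (+ 0) n b (M a) ⟩
    M a b ∎)
  where
    open ≡-Reasoning
    a' b' : ℕ
    a' = toℕ a
    b' = toℕ b
    row : ℕ → ℤ
    row k = atℤ n k (M a)
    cancel-corners : ∀ p q r s → (p + r - p) - (q + s - q) ≡ r - s
    cancel-corners = solve-∀
    cancel-prefix : ∀ p q → (p + q) - p ≡ q
    cancel-prefix = solve-∀

UnitStep : ℕ → ℕ → Set
UnitStep x y = y ≡ x ⊎ y ≡ suc x

unitStep : ∀ {x y} → x ≤ y → y ≤ suc x → UnitStep x y
unitStep x≤y y≤1+x with ℕP.m≤n⇒m<n∨m≡n y≤1+x
... | inj₂ y≡1+x      = inj₂ y≡1+x
... | inj₁ (s≤s y≤x) = inj₁ (ℕP.≤-antisym y≤x x≤y)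

record CornerProfile (n : ℕ) (c : ℕ → ℕ → ℕ) : Set where
  field
    row-step : ∀ i j → UnitStep (c i j) (c (suc i) j)
    col-step : ∀ i j → UnitStep (c i j) (c i (suc j))
    top      : ∀ j → c 0 j ≡ 0
    left     : ∀ i → c i 0 ≡ 0
    full     : c n n ≡ n

transposeProfile : ∀ {n c} → CornerProfile n c → CornerProfile n (λ i j → c j i)
transposeProfile cp = record
  { row-step = λ i j → col-step j i ; col-step = λ i j → row-step j i
  ; top = left ; left = top ; full = full }
  where open CornerProfile cp

unitStep-≤ : ∀ {x y} → UnitStep x y → x ≤ y × y ≤ suc x
unitStep-≤ {x} (inj₁ refl) = ℕP.≤-refl , ℕP.n≤1+n x
unitStep-≤ {x} (inj₂ refl) = ℕP.n≤1+n x , ℕP.≤-refl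

∣1+n-n∣≤1 : ∀ n → ∣ suc n - n ∣ ≤ 1
∣1+n-n∣≤1 zero    = s≤s z≤n
∣1+n-n∣≤1 (suc n) = ∣1+n-n∣≤1 n

∣n-n∣≤1 : ∀ n → ∣ n - n ∣ ≤ 1
∣n-n∣≤1 n rewrite ℕP.∣n-n∣≡0 n = z≤n

∸-≤-shift : ∀ a t x y → x ≤ y ℕ.+ t → a ∸ y ≤ (a ℕ.+ t) ∸ x
∸-≤-shift a t x y x≤y+t = subst (_≤ (a ℕ.+ t) ∸ x) cancel (ℕP.∸-monoʳ-≤ (a ℕ.+ t) x≤y+t)
  where
    cancel : (a ℕ.+ t) ∸ (y ℕ.+ t) ≡ a ∸ y
    cancel rewrite ℕP.+-comm a t | ℕP.+-comm y t = ℕP.[m+n]∸[m+o]≡n∸o t a y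

-- m + n = 2 min(m,n) + |m - n|: how h⁽⁰⁾ enters the half-height identity.
m+n≡min+min+dist : ∀ m n → m ℕ.+ n ≡ (m ⊓ n) ℕ.+ (m ⊓ n) ℕ.+ ∣ m - n ∣
m+n≡min+min+dist zero    n       = refl
m+n≡min+min+dist (suc m) zero    = cong suc (ℕP.+-identityʳ m)
m+n≡min+min+dist (suc m) (suc n) rewrite ℕP.+-suc m n | ℕP.+-suc (m ⊓ n) (m ⊓ n) =
  cong (λ v → suc (suc v)) (m+n≡min+min+dist m n)

-- If I + J = 2(x + c) + d then 2x = (I + J - 2c) - d; this turns
-- min(i,j) = δ + c into the half-height identity.
halve : ∀ I J c x d → I ℕ.+ J ≡ (x ℕ.+ c) ℕ.+ (x ℕ.+ c) ℕ.+ d →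
  + 2 * + x ≡ (+ I + + J - + 2 * + c) - + d
halve I J c x d e = begin
    + 2 * + x
  ≡⟨ expand (+ x) (+ c) (+ d) ⟩
    ((+ x + + c) + (+ x + + c) + + d - + 2 * + c) - + d
  ≡⟨ cong (λ v → (v - + 2 * + c) - + d) (sym e-ℤ) ⟩
    (+ I + + J - + 2 * + c) - + d ∎
  where
    open ≡-Reasoning
    expand : ∀ x c d → + 2 * x ≡ ((x + c) + (x + c) + d - + 2 * c) - d
    expand = solve-∀
    e-ℤ : + I + + J ≡ (+ x + + c) + (+ x + + c) + + d
    e-ℤ = trans (sym (ℤP.pos-+ I J)) (trans (cong +_ e)
          (trans (ℤP.pos-+ ((x ℕ.+ c) ℕ.+ (x ℕ.+ c)) d)
          (cong (_+ + d) (trans (ℤP.pos-+ (x ℕ.+ c) (x ℕ.+ c)) (cong₂ _+_ (ℤP.pos-+ x c) (ℤP.pos-+ x c))))))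

module ProfileIsland {n : ℕ} {c : ℕ → ℕ → ℕ} (cp : CornerProfile n c) where
  open CornerProfile cp

  c≤row : ∀ i j → c i j ≤ i
  c≤row zero    j rewrite top j = z≤n
  c≤row (suc i) j = ℕP.≤-trans (proj₂ (unitStep-≤ (row-step i j))) (s≤s (c≤row i j))

  c≤col : ∀ i j → c i j ≤ j
  c≤col i zero    rewrite left i = z≤n
  c≤col i (suc j) = ℕP.≤-trans (proj₂ (unitStep-≤ (col-step i j))) (s≤s (c≤col i j))

  c≤min : ∀ i j → c i j ≤ i ⊓ j
  c≤min i j = ℕP.⊓-glb (c≤row i j) (c≤col i j)

  row-mono : ∀ i t j → c i j ≤ c (i ℕ.+ t) j
  row-mono i zero    j rewrite ℕP.+-identityʳ i = ℕP.≤-refl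
  row-mono i (suc t) j rewrite ℕP.+-suc i t =
    ℕP.≤-trans (row-mono i t j) (proj₁ (unitStep-≤ (row-step (i ℕ.+ t) j)))

  col-lipschitz : ∀ i j t → c i (j ℕ.+ t) ≤ c i j ℕ.+ t
  col-lipschitz i j zero    rewrite ℕP.+-identityʳ j | ℕP.+-identityʳ (c i j) = ℕP.≤-refl
  col-lipschitz i j (suc t) rewrite ℕP.+-suc j t | ℕP.+-suc (c i j) t =
    ℕP.≤-trans (proj₂ (unitStep-≤ (col-step i (j ℕ.+ t)))) (s≤s (col-lipschitz i j t))

  dyck-i : ∀ i j i' j' → j ≤ i → i ≤ i' → j' ≤ j → (i' ⊓ j') ∸ c i' j' ≤ (i ⊓ j) ∸ c i j
  dyck-i i j i' j' j≤i i≤i' j'≤j =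
    subst₂ (λ u v → u ∸ c i' j' ≤ v ∸ c i j)
      (sym (ℕP.m≥n⇒m⊓n≡n (ℕP.≤-trans j'≤j (ℕP.≤-trans j≤i i≤i')))) (sym (ℕP.m≥n⇒m⊓n≡n j≤i))
      (subst (λ v → j' ∸ c i' j' ≤ v ∸ c i j) (ℕP.m+[n∸m]≡n j'≤j)
        (∸-≤-shift j' (j ∸ j') (c i j) (c i' j') (ℕP.≤-trans along-row (ℕP.+-monoˡ-≤ (j ∸ j') down-col))))
    where
      along-row : c i j ≤ c i j' ℕ.+ (j ∸ j')
      along-row = subst (λ v → c i v ≤ c i j' ℕ.+ (j ∸ j')) (ℕP.m+[n∸m]≡n j'≤j) (col-lipschitz i j' (j ∸ j'))
      down-col : c i j' ≤ c i' j'
      down-col = subst (λ v → c i j' ≤ c v j') (ℕP.m+[n∸m]≡n i≤i') (row-mono i (i' ∸ i) j')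

  dyck-iv : ∀ i j → ∣ ((i ⊓ j) ∸ c i j) - ((suc i ⊓ j) ∸ c (suc i) j) ∣ ≤ 1
  dyck-iv i j with ℕP.≤-<-connex j i
  ... | inj₁ j≤i rewrite ℕP.m≥n⇒m⊓n≡n j≤i | ℕP.m≥n⇒m⊓n≡n (ℕP.m≤n⇒m≤1+n j≤i) =
        below (row-step i j)
    where
      below : UnitStep (c i j) (c (suc i) j) → ∣ (j ∸ c i j) - (j ∸ c (suc i) j) ∣ ≤ 1
      below (inj₁ same) rewrite same = ∣n-n∣≤1 (j ∸ c i j)
      below (inj₂ next) rewrite next =
        subst (λ v → ∣ v - j ∸ suc (c i j) ∣ ≤ 1)
          (sym (ℕP.+-∸-assoc 1 (subst (_≤ j) next (c≤col (suc i) j)))) (∣1+n-n∣≤1 (j ∸ suc (c i j)))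
  ... | inj₂ i<j rewrite ℕP.m≤n⇒m⊓n≡m (ℕP.<⇒≤ i<j) | ℕP.m≤n⇒m⊓n≡m i<j = above (row-step i j)
    where
      above : UnitStep (c i j) (c (suc i) j) → ∣ (i ∸ c i j) - (suc i ∸ c (suc i) j) ∣ ≤ 1
      above (inj₁ same) rewrite same | ℕP.+-∸-assoc 1 (c≤row i j) =
        subst (_≤ 1) (ℕP.∣-∣-comm (suc (i ∸ c i j)) (i ∸ c i j)) (∣1+n-n∣≤1 (i ∸ c i j))
      above (inj₂ next) rewrite next = ∣n-n∣≤1 (i ∸ c i j)

  dyck-iii : ∀ i j → (i ≡ 1 ⊎ i ≡ n ∸ 1) → (j ≡ 1 ⊎ j ≡ n ∸ 1) → (i ⊓ j) ∸ c i j ≤ 1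
  dyck-iii i j (inj₁ refl) _ = ℕP.≤-trans (ℕP.m∸n≤m (1 ⊓ j) (c 1 j)) (ℕP.m⊓n≤m 1 j)
  dyck-iii i j _ (inj₁ refl) = ℕP.≤-trans (ℕP.m∸n≤m (i ⊓ 1) (c i 1)) (ℕP.m⊓n≤n i 1)
  dyck-iii i j (inj₂ refl) (inj₂ refl) = last-cell n refl
    where
      -- c (k+1) (k+1) = k+1 and two unit steps give k ≤ 1 + c k k.
      last-cell : ∀ n' → n' ≡ n → ((n' ∸ 1) ⊓ (n' ∸ 1)) ∸ c (n' ∸ 1) (n' ∸ 1) ≤ 1
      last-cell zero    _ = ℕP.≤-trans (ℕP.m∸n≤m 0 (c 0 0)) z≤n
      last-cell (suc k) n'≡n rewrite ℕP.⊓-idem k = ℕP.m≤n+o⇒m∸n≤o k (c k k)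
          (subst (k ≤_) (ℕP.+-comm 1 (c k k))
            (ℕP.≤-pred (ℕP.≤-trans (ℕP.≤-reflexive diag)
              (ℕP.≤-trans (proj₂ (unitStep-≤ (row-step k (suc k)))) (s≤s (proj₂ (unitStep-≤ (col-step k k))))))))
        where
          diag : suc k ≡ c (suc k) (suc k)
          diag = subst (λ v → v ≡ c v v) (sym n'≡n) (sym full)

  twice-island : ∀ I J → + 2 * + ((I ⊓ J) ∸ c I J) ≡ (+ I + + J - + 2 * + c I J) - + ∣ I - J ∣
  twice-island I J = halve I J (c I J) ((I ⊓ J) ∸ c I J) ∣ I - J ∣
    (trans (m+n≡min+min+dist I J) (cong (λ v → v ℕ.+ v ℕ.+ ∣ I - J ∣) (sym (ℕP.m∸n+n≡m (c≤min I J)))))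

bit-abs : ∀ {v} → Bit v → v ≡ + ℤ.∣ v ∣
bit-abs (inj₁ refl) = refl
bit-abs (inj₂ refl) = refl

bit-≤1 : ∀ {v} → Bit v → ℤ.∣ v ∣ ≤ 1
bit-≤1 (inj₁ refl) = z≤n
bit-≤1 (inj₂ refl) = s≤s z≤n

psumℕ-step : ∀ f k → f k ≤ 1 → UnitStep (psumℕ f k) (psumℕ f (suc k))
psumℕ-step f k fk≤1 = unitStep (ℕP.m≤m+n (psumℕ f k) (f k))
  (ℕP.≤-trans (ℕP.+-monoʳ-≤ (psumℕ f k) fk≤1) (ℕP.≤-reflexive (ℕP.+-comm (psumℕ f k) 1)))

-- Corner sums counted in ℕ, through the absolute values of the partial row
-- sums; for an ASM these are 0 or 1, so this is the corner sum itself.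
cornerCount : {n : ℕ} → Matrix n → ℕ → ℕ → ℕ
cornerCount M i j = psumℕ (λ a → ℤ.∣ rowPartial M a j ∣) i

module ASMProfile {n : ℕ} (A : ASM n) where
  M : Matrix n
  M = proj₁ A
  open IsASM (proj₂ A)

  module Row (x : Fin n) = AlternatingSequence n (M x) (entries x) (rowSum x) (rowAlt x)
  module Col (y : Fin n) = AlternatingSequence n (λ a → M a y) (λ a → entries a y) (colSum y) (colAlt y)

  rowPartial-bit : ∀ a j → Bit (rowPartial M a j)
  rowPartial-bit a j = at-all Bit (+ 0) n a _ (inj₁ refl) (λ x → Row.partial-bit x j)

  colPartial-bit : ∀ i b → Bit (colPartial M i b)
  colPartial-bit i b = at-all Bit (+ 0) n b _ (inj₁ refl) (λ y → Col.partial-bit y i)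

  count≡corner : ∀ i j → + cornerCount M i j ≡ corner M i j
  count≡corner i j = trans (psumℕ-psum _ i) (psum-cong _ _ i (λ a _ → sym (bit-abs (rowPartial-bit a j))))

  count-by-columns : ∀ i j → cornerCount M i j ≡ psumℕ (λ b → ℤ.∣ colPartial M i b ∣) j
  count-by-columns i j = ℤP.+-injective (trans (count≡corner i j) (trans (corner-by-columns M i j)
    (trans (psum-cong _ _ j (λ b _ → bit-abs (colPartial-bit i b))) (sym (psumℕ-psum _ j)))))

  row-full : ∀ a → a < n → rowPartial M a n ≡ + 1
  row-full a a<n = trans (at-fromℕ< (+ 0) n a a<n _) (Row.g-total (fromℕ< a<n) 0)

  col-full : ∀ b → b < n → colPartial M n b ≡ + 1
  col-full b b<n = trans (at-fromℕ< (+ 0) n b b<n _) (Col.g-total (fromℕ< b<n) 0)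

  count-right : ∀ i → i ≤ n → cornerCount M i n ≡ i
  count-right i i≤n = psumℕ-ones n _ (λ a a<n → cong ℤ.∣_∣ (row-full a a<n)) i i≤n

  count-bottom : ∀ j → j ≤ n → cornerCount M n j ≡ j
  count-bottom j j≤n =
    trans (count-by-columns n j) (psumℕ-ones n _ (λ b b<n → cong ℤ.∣_∣ (col-full b b<n)) j j≤n)

  profile : CornerProfile n (cornerCount M)
  profile = record
    { row-step = λ i j → psumℕ-step _ i (bit-≤1 (rowPartial-bit i j))
    ; col-step = λ i j → subst₂ UnitStep (sym (count-by-columns i j)) (sym (count-by-columns i (suc j)))
                           (psumℕ-step _ j (bit-≤1 (colPartial-bit i j)))
    ; top      = λ j → refl
    ; left     = λ i → count-by-columns i 0
    ; full     = count-right n ℕP.≤-refl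
    }

islandOf : {n : ℕ} → Matrix n → Array n
islandOf M i j = (ix i ⊓ ix j) ∸ cornerCount M (ix i) (ix j)

-- The forward map: an ASM gives a Dyck island.  Conditions (ii) and (iv)
-- along rows are conditions (i) and (iv) for the transposed profile.
toIsland : {n : ℕ} → ASM n → DyckIsland n
toIsland {n} A = islandOf M , record
  { cond-i   = λ i j i' j' → dyck-i (ix i) (ix j) (ix i') (ix j')
  ; cond-ii  = λ i j i' j' i≤j i'≤i j≤j' →
      subst₂ (λ u v → u ∸ cornerCount M (ix i') (ix j') ≤ v ∸ cornerCount M (ix i) (ix j))
        (ℕP.⊓-comm (ix j') (ix i')) (ℕP.⊓-comm (ix j) (ix i))
        (T.dyck-i (ix j) (ix i) (ix j') (ix i') i≤j j≤j' i'≤i)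
  ; cond-iii = λ i j → dyck-iii (ix i) (ix j)
  ; cond-ivr = λ i i' j i'≡1+i →
      subst (λ v → ∣ islandOf M i j - (v ⊓ ix j) ∸ cornerCount M v (ix j) ∣ ≤ 1) (sym i'≡1+i)
        (dyck-iv (ix i) (ix j))
  ; cond-ivc = λ i j j' j'≡1+j →
      subst (λ v → ∣ islandOf M i j - (ix i ⊓ v) ∸ cornerCount M (ix i) v ∣ ≤ 1) (sym j'≡1+j)
        (subst₂ (λ u v → ∣ u ∸ cornerCount M (ix i) (ix j) - v ∸ cornerCount M (ix i) (suc (ix j)) ∣ ≤ 1)
          (ℕP.⊓-comm (ix j) (ix i)) (ℕP.⊓-comm (suc (ix j)) (ix i)) (T.dyck-iv (ix j) (ix i)))
  }
  where
    open ASMProfile A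
    open ProfileIsland profile
    module T = ProfileIsland (transposeProfile profile)

toIsland-height : {n : ℕ} (A : ASM n) → IsHalfHeightDiff n (proj₁ A) (proj₁ (toIsland A))
toIsland-height A i j
  rewrite cornerSum≡corner (proj₁ A) (ix i) (ix j) | sym (ASMProfile.count≡corner A (ix i) (ix j)) =
  ProfileIsland.twice-island (ASMProfile.profile A) (ix i) (ix j)

-- The forward map is injective: equal islands force equal corner sums on the
-- whole grid 0..n (inside by cancelling min(i,j), on the border by the
-- profile), hence equal second differences.
module Injectivity (m : ℕ) (A B : ASM (suc m))
  (same : ∀ i j → proj₁ (toIsland A) i j ≡ proj₁ (toIsland B) i j) where
  n : ℕ
  n = suc m

  module PA = ASMProfile A
  module PB = ASMProfile B
  module IA = ProfileIsland PA.profile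
  module IB = ProfileIsland PB.profile

  same-count : ∀ i j → i ≤ n → j ≤ n → cornerCount (proj₁ A) i j ≡ cornerCount (proj₁ B) i j
  same-count zero    j       _ _ = refl
  same-count (suc i) zero    _ _ = trans (PA.count-by-columns (suc i) 0) (sym (PB.count-by-columns (suc i) 0))
  same-count (suc i) (suc j) i<n j<n with ℕP.m≤n⇒m<n∨m≡n i<n | ℕP.m≤n⇒m<n∨m≡n j<n
  ... | inj₂ bottom | _ =
        subst (λ v → cornerCount (proj₁ A) v (suc j) ≡ cornerCount (proj₁ B) v (suc j)) (sym bottom)
          (trans (PA.count-bottom (suc j) j<n) (sym (PB.count-bottom (suc j) j<n)))
  ... | inj₁ _ | inj₂ right =
        subst (λ v → cornerCount (proj₁ A) (suc i) v ≡ cornerCount (proj₁ B) (suc i) v) (sym right)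
          (trans (PA.count-right (suc i) i<n) (sym (PB.count-right (suc i) i<n)))
  ... | inj₁ (s≤s i<m) | inj₁ (s≤s j<m) =
        ℕP.∸-cancelˡ-≡ (IA.c≤min (suc i) (suc j)) (IB.c≤min (suc i) (suc j)) inner
    where
      inner : (suc i ⊓ suc j) ∸ cornerCount (proj₁ A) (suc i) (suc j)
            ≡ (suc i ⊓ suc j) ∸ cornerCount (proj₁ B) (suc i) (suc j)
      inner = subst₂ (λ u v → (suc u ⊓ suc v) ∸ cornerCount (proj₁ A) (suc u) (suc v)
                            ≡ (suc u ⊓ suc v) ∸ cornerCount (proj₁ B) (suc u) (suc v))
                (toℕ-fromℕ< i<m) (toℕ-fromℕ< j<m) (same (fromℕ< i<m) (fromℕ< j<m))

  same-corner : ∀ i j → i ≤ n → j ≤ n → corner (proj₁ A) i j ≡ corner (proj₁ B) i j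
  same-corner i j i≤n j≤n =
    trans (sym (PA.count≡corner i j)) (trans (cong +_ (same-count i j i≤n j≤n)) (PB.count≡corner i j))

  same-entries : ∀ a b → proj₁ A a b ≡ proj₁ B a b
  same-entries a b = trans (entry-second-difference (proj₁ A) a b) (trans
    (cong₂ _-_ (cong₂ _-_ (same-corner _ _ a<n b<n) (same-corner _ _ a≤n b<n))
               (cong₂ _-_ (same-corner _ _ a<n b≤n) (same-corner _ _ a≤n b≤n)))
    (sym (entry-second-difference (proj₁ B) a b)))
    where
      a<n : toℕ a < n
      a<n = toℕ<n a
      b<n : toℕ b < n
      b<n = toℕ<n b
      a≤n : toℕ a ≤ n
      a≤n = ℕP.<⇒≤ a<n
      b≤n : toℕ b ≤ n
      b≤n = ℕP.<⇒≤ b<n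

-- An island on positions 1..m padded with zeros to the grid 0..m+1.
padded : (m : ℕ) → (Fin m → Fin m → ℕ) → ℕ → ℕ → ℕ
padded m δ zero    j       = 0
padded m δ (suc i) zero    = 0
padded m δ (suc i) (suc j) = at 0 m i (λ x → at 0 m j (δ x))

padded-transpose : (m : ℕ) (δ : Fin m → Fin m → ℕ) (i j : ℕ) →
  padded m (λ x y → δ y x) i j ≡ padded m δ j i
padded-transpose m δ zero    zero    = refl
padded-transpose m δ zero    (suc j) = refl
padded-transpose m δ (suc i) zero    = refl
padded-transpose m δ (suc i) (suc j) = at-swap 0 m m i j (λ x y → δ y x)

transposeIsland : {n : ℕ} {δ : Array n} → IsDyckIsland n δ → IsDyckIsland n (λ x y → δ y x)
transposeIsland D = record
  { cond-i   = λ i j i' j' j≤i i≤i' j'≤j → cond-ii j i j' i' j≤i j'≤j i≤i'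
  ; cond-ii  = λ i j i' j' i≤j i'≤i j≤j' → cond-i j i j' i' i≤j j≤j' i'≤i
  ; cond-iii = λ i j ci cj → cond-iii j i cj ci
  ; cond-ivr = λ i i' j e → cond-ivc j i i' e
  ; cond-ivc = λ i j j' e → cond-ivr j j' i e }
  where open IsDyckIsland D

dist≤1 : ∀ x y → ∣ x - y ∣ ≤ 1 → x ≤ suc y × y ≤ suc x
dist≤1 zero    y       d = z≤n , d
dist≤1 (suc x) zero    d = d , z≤n
dist≤1 (suc x) (suc y) d with dist≤1 x y d
... | x≤1+y , y≤1+x = s≤s x≤1+y , s≤s y≤1+x

-- The two possible increments of (+ p - + y) - (+ q - + x), according as the
-- position is on/below the diagonal (p = q = j) or above it (p = a + 1, q = a).
bit-below : ∀ {p q j x y} → p ≡ j → q ≡ j → UnitStep y x → Bit ((+ p - + y) - (+ q - + x))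
bit-below {j = j} {y = y} refl refl (inj₁ refl) = inj₁ (ℤP.+-inverseʳ (+ j - + y))
bit-below {j = j} {y = y} refl refl (inj₂ refl) = inj₂ (drop-one (+ j) (+ y))
  where
    drop-one : ∀ u v → (u - v) - (u - (+ 1 + v)) ≡ + 1
    drop-one = solve-∀

above-value : ∀ {p q a} x → p ≡ suc a → q ≡ a → (+ p - + x) - (+ q - + x) ≡ + 1
above-value {a = a} x refl refl = gain-one (+ a) (+ x)
  where
    gain-one : ∀ u v → ((+ 1 + u) - v) - (u - v) ≡ + 1
    gain-one = solve-∀

bit-above : ∀ {p q a x y} → p ≡ suc a → q ≡ a → UnitStep x y → Bit ((+ p - + y) - (+ q - + x))
bit-above {x = x} p≡1+a q≡a (inj₁ refl) = inj₂ (above-value x p≡1+a q≡a)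
bit-above {a = a} {x = x} refl refl (inj₂ refl) = inj₁ (balanced (+ a) (+ x))
  where
    balanced : ∀ u v → ((+ 1 + u) - (+ 1 + v)) - (u - v) ≡ + 0
    balanced = solve-∀

-- The candidate corner sums cornerOf i j = min(i,j) - δ_{ij} of a Dyck island
-- δ of size m+1.  Conditions (i)-(iv) say exactly that the padded island
-- changes by 0 or 1 between consecutive rows, in the direction that makes
-- every increment cornerOf (a+1) j - cornerOf a j equal to 0 or 1.
module IslandCorner (m : ℕ) (δ : Fin m → Fin m → ℕ) (D : IsDyckIsland (suc m) δ) where
  open IsDyckIsland D

  pad : ℕ → ℕ → ℕ
  pad = padded m δ

  ix-fromℕ< : ∀ {k} (k<m : k < m) → ix (fromℕ< k<m) ≡ suc k
  ix-fromℕ< k<m = cong suc (toℕ-fromℕ< k<m)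

  ix-≤ : ∀ {j i} (j<m : j < m) (i<m : i < m) → j ≤ i → ix (fromℕ< j<m) ≤ ix (fromℕ< i<m)
  ix-≤ j<m i<m j≤i = subst₂ _≤_ (sym (ix-fromℕ< j<m)) (sym (ix-fromℕ< i<m)) (s≤s j≤i)

  pad-inner : ∀ {i j} (i<m : i < m) (j<m : j < m) → pad (suc i) (suc j) ≡ δ (fromℕ< i<m) (fromℕ< j<m)
  pad-inner {i} {j} i<m j<m = trans (at-fromℕ< 0 m i i<m _) (at-fromℕ< 0 m j j<m _)

  pad-left : ∀ i → pad i 0 ≡ 0
  pad-left zero    = refl
  pad-left (suc i) = refl

  pad-right : ∀ i → pad i (suc m) ≡ 0
  pad-right zero    = refl
  pad-right (suc i) =
    trans (at-cong 0 m i _ (λ _ → 0) (λ x → at-out 0 m m ℕP.≤-refl (δ x))) (at-const 0 m i)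

  pad-bottom : ∀ j → pad (suc m) j ≡ 0
  pad-bottom zero    = refl
  pad-bottom (suc j) = at-out 0 m m ℕP.≤-refl _

  below-mono : ∀ {i j i' j'} → i' < m → j ≤ i → i ≤ i' → j' ≤ j → pad (suc i') (suc j') ≤ pad (suc i) (suc j)
  below-mono {i} {j} {i'} {j'} i'<m j≤i i≤i' j'≤j = subst₂ _≤_ (sym (pad-inner i'<m j'<m)) (sym (pad-inner i<m j<m))
      (cond-i _ _ _ _ (ix-≤ j<m i<m j≤i) (ix-≤ i<m i'<m i≤i') (ix-≤ j'<m j<m j'≤j))
    where
      i<m : i < m
      i<m = ℕP.≤-<-trans i≤i' i'<m
      j<m : j < m
      j<m = ℕP.≤-<-trans j≤i i<m
      j'<m : j' < m
      j'<m = ℕP.≤-<-trans j'≤j j<m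

  above-mono : ∀ {i j i' j'} → j' < m → i ≤ j → i' ≤ i → j ≤ j' → pad (suc i') (suc j') ≤ pad (suc i) (suc j)
  above-mono {i} {j} {i'} {j'} j'<m i≤j i'≤i j≤j' = subst₂ _≤_ (sym (pad-inner i'<m j'<m)) (sym (pad-inner i<m j<m))
      (cond-ii _ _ _ _ (ix-≤ i<m j<m i≤j) (ix-≤ i'<m i<m i'≤i) (ix-≤ j<m j'<m j≤j'))
    where
      j<m : j < m
      j<m = ℕP.≤-<-trans j≤j' j'<m
      i<m : i < m
      i<m = ℕP.≤-<-trans i≤j j<m
      i'<m : i' < m
      i'<m = ℕP.≤-<-trans i'≤i i<m

  down-step : ∀ {i j} → suc i < m → j < m →
    pad (suc i) (suc j) ≤ suc (pad (suc (suc i)) (suc j)) × pad (suc (suc i)) (suc j) ≤ suc (pad (suc i) (suc j))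
  down-step {i} {j} 1+i<m j<m = dist≤1 _ _
      (subst₂ (λ u v → ∣ u - v ∣ ≤ 1) (sym (pad-inner i<m j<m)) (sym (pad-inner 1+i<m j<m))
        (cond-ivr (fromℕ< i<m) (fromℕ< 1+i<m) (fromℕ< j<m)
          (trans (ix-fromℕ< 1+i<m) (cong suc (sym (ix-fromℕ< i<m))))))
    where
      i<m : i < m
      i<m = ℕP.<-trans (ℕP.n<1+n i) 1+i<m

  first-row-bit : ∀ {j} → j < m → pad 1 (suc j) ≤ 1
  first-row-bit j<m = ℕP.≤-trans (above-mono j<m z≤n z≤n z≤n) corner-cell
    where
      0<m : 0 < m
      0<m = ℕP.≤-<-trans z≤n j<m
      corner-cell : pad 1 1 ≤ 1
      corner-cell = subst (_≤ 1) (sym (pad-inner 0<m 0<m))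
        (cond-iii _ _ (inj₁ (ix-fromℕ< 0<m)) (inj₁ (ix-fromℕ< 0<m)))

  last-row-bit : ∀ {a j} → suc a ≡ m → j ≤ a → pad (suc a) (suc j) ≤ 1
  last-row-bit {a} last j≤a = ℕP.≤-trans (below-mono a<m ℕP.≤-refl ℕP.≤-refl j≤a) corner-cell
    where
      a<m : a < m
      a<m = subst (a <_) last ℕP.≤-refl
      corner-cell : pad (suc a) (suc a) ≤ 1
      corner-cell = subst (_≤ 1) (sym (pad-inner a<m a<m))
        (cond-iii _ _ (inj₂ (trans (ix-fromℕ< a<m) last)) (inj₂ (trans (ix-fromℕ< a<m) last)))

  step-below : ∀ {a j} → a ≤ m → j ≤ a → UnitStep (pad (suc a) j) (pad a j)
  step-below {a}     {zero}  _   _         = inj₁ (pad-left a)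
  step-below {zero}  {suc j} _   ()
  step-below {suc a} {suc j} a<m (s≤s j≤a) with ℕP.m≤n⇒m<n∨m≡n a<m
  ... | inj₁ 1+a<m = unitStep (below-mono 1+a<m j≤a (ℕP.n≤1+n a) ℕP.≤-refl)
                      (proj₁ (down-step 1+a<m (ℕP.≤-<-trans j≤a (ℕP.<-trans (ℕP.n<1+n a) 1+a<m))))
  ... | inj₂ last  = subst (λ z → UnitStep z (pad (suc a) (suc j)))
                      (sym (trans (cong (λ i → pad (suc i) (suc j)) last) (pad-bottom (suc j))))
                      (unitStep z≤n (last-row-bit last j≤a))

  step-above : ∀ {a j} → a < j → j ≤ suc m → UnitStep (pad a j) (pad (suc a) j)
  step-above {a} {suc j} a<j (s≤s j≤m) with ℕP.m≤n⇒m<n∨m≡n j≤m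
  ... | inj₂ refl = inj₁ (trans (pad-right (suc a)) (sym (pad-right a)))
  step-above {zero}  {suc j} _ _ | inj₁ j<m = unitStep z≤n (first-row-bit j<m)
  step-above {suc a} {suc j} (s≤s a<j) _ | inj₁ j<m =
    unitStep (above-mono j<m a<j (ℕP.n≤1+n a) ℕP.≤-refl) (proj₂ (down-step (ℕP.<-≤-trans (s≤s a<j) j<m) j<m))

  cornerOf : ℕ → ℕ → ℤ
  cornerOf i j = + (i ⊓ j) - + pad i j

  -- The partial sum of row a up to column j of the matrix to be built.
  rowIncrement : ℕ → ℕ → ℤ
  rowIncrement a j = cornerOf (suc a) j - cornerOf a j

  rowIncrement-bit : ∀ a j → a ≤ m → j ≤ suc m → Bit (rowIncrement a j)
  rowIncrement-bit a j a≤m j≤n with ℕP.≤-<-connex j a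
  ... | inj₁ j≤a =
        bit-below (ℕP.m≥n⇒m⊓n≡n (ℕP.m≤n⇒m≤1+n j≤a)) (ℕP.m≥n⇒m⊓n≡n j≤a) (step-below a≤m j≤a)
  ... | inj₂ a<j = bit-above (ℕP.m≤n⇒m⊓n≡m a<j) (ℕP.m≤n⇒m⊓n≡m (ℕP.<⇒≤ a<j)) (step-above a<j j≤n)

  rowIncrement-start : ∀ a → rowIncrement a 0 ≡ + 0
  rowIncrement-start zero    = refl
  rowIncrement-start (suc a) = refl

  rowIncrement-end : ∀ a → a ≤ m → rowIncrement a (suc m) ≡ + 1
  rowIncrement-end a a≤m = begin
      rowIncrement a (suc m)
    ≡⟨ cong₂ (λ y x → (+ (suc a ⊓ suc m) - + y) - (+ (a ⊓ suc m) - + x)) (pad-right (suc a)) (pad-right a) ⟩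
      (+ (suc a ⊓ suc m) - + 0) - (+ (a ⊓ suc m) - + 0)
    ≡⟨ above-value 0 (ℕP.m≤n⇒m⊓n≡m (s≤s a≤m)) (ℕP.m≤n⇒m⊓n≡m (ℕP.m≤n⇒m≤1+n a≤m)) ⟩
      + 1 ∎
    where open ≡-Reasoning

bit-difference : ∀ {x y} → Bit x → Bit y → Sign (y - x)
bit-difference (inj₁ refl) (inj₁ refl) = inj₁ refl
bit-difference (inj₁ refl) (inj₂ refl) = inj₂ (inj₁ refl)
bit-difference (inj₂ refl) (inj₁ refl) = inj₂ (inj₂ refl)
bit-difference (inj₂ refl) (inj₂ refl) = inj₁ refl

bit-steps-alternate : ∀ {x y z} → Bit x → Bit y → Bit z → y - x ≢ + 0 → z - y ≢ + 0 → z - y ≡ - (y - x)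
bit-steps-alternate (inj₁ refl) (inj₁ refl) _           x≢y _   = ⊥-elim (x≢y refl)
bit-steps-alternate (inj₂ refl) (inj₂ refl) _           x≢y _   = ⊥-elim (x≢y refl)
bit-steps-alternate _           (inj₁ refl) (inj₁ refl) _   y≢z = ⊥-elim (y≢z refl)
bit-steps-alternate _           (inj₂ refl) (inj₂ refl) _   y≢z = ⊥-elim (y≢z refl)
bit-steps-alternate (inj₁ refl) (inj₂ refl) (inj₁ refl) _   _   = refl
bit-steps-alternate (inj₂ refl) (inj₁ refl) (inj₂ refl) _   _   = refl

constant-run : (R : ℕ → ℤ) (s e : ℕ) → (∀ k → s < k → k < e → R (suc k) ≡ R k) →
  ∀ t → suc s ℕ.+ t ≤ e → R (suc s ℕ.+ t) ≡ R (suc s)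
constant-run R s e flat zero    _ = cong R (ℕP.+-identityʳ (suc s))
constant-run R s e flat (suc t) p rewrite ℕP.+-suc (suc s) t =
  trans (flat (suc s ℕ.+ t) (s≤s (ℕP.m≤m+n s t)) p) (constant-run R s e flat t (ℕP.<⇒≤ p))

module BitDifferences (n : ℕ) (R : ℕ → ℤ) (R-bit : ∀ j → j ≤ n → Bit (R j)) (f : Fin n → ℤ)
  (f≡step : ∀ y → f y ≡ R (suc (toℕ y)) - R (toℕ y)) where

  sign : ∀ y → Sign (f y)
  sign y = subst Sign (sym (f≡step y))
    (bit-difference (R-bit (toℕ y) (ℕP.<⇒≤ (toℕ<n y))) (R-bit (suc (toℕ y)) (toℕ<n y)))

  sum : sumFin f ≡ R n - R 0
  sum = trans (sumFin≡psum n f (λ y → R (suc (toℕ y)) - R (toℕ y)) f≡step)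
    (trans (psum-cong _ _ n (λ k k<n → at-fun (+ 0) n k (λ k → R (suc k) - R k) k<n)) (psum-telescope R n))

  alternates : ∀ b b' → toℕ b < toℕ b' → f b ≢ + 0 → f b' ≢ + 0 →
    (∀ c → toℕ b < toℕ c → toℕ c < toℕ b' → f c ≡ + 0) → f b' ≡ - f b
  alternates b b' s<e fb≢0 fb'≢0 between =
    trans (f≡step b') (trans (cong (λ v → R (suc e) - v) R-e)
      (trans (bit-steps-alternate (R-bit s (ℕP.<⇒≤ (toℕ<n b))) (R-bit (suc s) (toℕ<n b)) (R-bit (suc e) (toℕ<n b'))
                (λ q → fb≢0 (trans (f≡step b) q))
                (λ q → fb'≢0 (trans (f≡step b') (trans (cong (λ v → R (suc e) - v) R-e) q))))
        (cong -_ (sym (f≡step b)))))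
    where
      s e : ℕ
      s = toℕ b
      e = toℕ b'
      flat : ∀ k → s < k → k < e → R (suc k) ≡ R k
      flat k s<k k<e = ℤP.i-j≡0⇒i≡j (R (suc k)) (R k)
        (trans (sym (subst (λ v → f c ≡ R (suc v) - R v) (toℕ-fromℕ< k<n) (f≡step c)))
               (between c (subst (s <_) (sym (toℕ-fromℕ< k<n)) s<k) (subst (_< e) (sym (toℕ-fromℕ< k<n)) k<e)))
        where
          k<n : k < n
          k<n = ℕP.<-trans k<e (toℕ<n b')
          c : Fin n
          c = fromℕ< k<n
      R-e : R e ≡ R (suc s)
      R-e = subst (λ v → R v ≡ R (suc s)) (ℕP.m+[n∸m]≡n s<e)
              (constant-run R s e flat (e ∸ suc s) (ℕP.≤-reflexive (ℕP.m+[n∸m]≡n s<e)))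

module FromIsland (m : ℕ) (δ : Fin m → Fin m → ℕ) (D : IsDyckIsland (suc m) δ) where
  n : ℕ
  n = suc m

  module K  = IslandCorner m δ D
  module Kᵀ = IslandCorner m (λ x y → δ y x) (transposeIsland D)

  -- Partial sum of column b down to row i.
  colIncrement : ℕ → ℕ → ℤ
  colIncrement i b = K.cornerOf i (suc b) - K.cornerOf i b

  cornerOf-transpose : ∀ i j → Kᵀ.cornerOf j i ≡ K.cornerOf i j
  cornerOf-transpose i j = cong₂ (λ u v → + u - + v) (ℕP.⊓-comm j i) (padded-transpose m δ j i)

  colIncrement≡ : ∀ i b → colIncrement i b ≡ Kᵀ.rowIncrement b i
  colIncrement≡ i b = sym (cong₂ _-_ (cornerOf-transpose i (suc b)) (cornerOf-transpose i b))

  matrix : Matrix n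
  matrix x y = K.rowIncrement (toℕ x) (suc (toℕ y)) - K.rowIncrement (toℕ x) (toℕ y)

  matrix-by-columns : ∀ x y → matrix x y ≡ colIncrement (suc (toℕ x)) (toℕ y) - colIncrement (toℕ x) (toℕ y)
  matrix-by-columns x y = swap-differences (K.cornerOf (suc (toℕ x)) (suc (toℕ y))) (K.cornerOf (toℕ x) (suc (toℕ y)))
                                           (K.cornerOf (suc (toℕ x)) (toℕ y)) (K.cornerOf (toℕ x) (toℕ y))
    where
      swap-differences : ∀ p q r s → (p - q) - (r - s) ≡ (p - r) - (q - s)
      swap-differences = solve-∀

  row-bit : ∀ (a : Fin n) j → j ≤ n → Bit (K.rowIncrement (toℕ a) j)
  row-bit a j j≤n = K.rowIncrement-bit (toℕ a) j (ℕP.≤-pred (toℕ<n a)) j≤n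

  col-bit : ∀ (b : Fin n) i → i ≤ n → Bit (colIncrement i (toℕ b))
  col-bit b i i≤n =
    subst Bit (sym (colIncrement≡ i (toℕ b))) (Kᵀ.rowIncrement-bit (toℕ b) i (ℕP.≤-pred (toℕ<n b)) i≤n)

  module Row (a : Fin n) =
    BitDifferences n (K.rowIncrement (toℕ a)) (row-bit a) (matrix a) (λ _ → refl)
  module Col (b : Fin n) =
    BitDifferences n (λ i → colIncrement i (toℕ b)) (col-bit b) (λ a → matrix a b) (λ a → matrix-by-columns a b)

  isASM : IsASM n matrix
  isASM = record
    { entries = λ a b → Row.sign a b
    ; rowSum  = λ a → trans (Row.sum a)
        (cong₂ _-_ (K.rowIncrement-end (toℕ a) (ℕP.≤-pred (toℕ<n a))) (K.rowIncrement-start (toℕ a)))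
    ; colSum  = λ b → trans (Col.sum b)
        (cong₂ _-_ (trans (colIncrement≡ n (toℕ b)) (Kᵀ.rowIncrement-end (toℕ b) (ℕP.≤-pred (toℕ<n b))))
                   (trans (colIncrement≡ 0 (toℕ b)) (Kᵀ.rowIncrement-start (toℕ b))))
    ; rowAlt  = Row.alternates
    ; colAlt  = Col.alternates
    }

  asm : ASM n
  asm = matrix , isASM

  rowPartial-matrix : ∀ a j → a < n → j ≤ n → rowPartial matrix a j ≡ K.rowIncrement a j
  rowPartial-matrix a j a<n j≤n = begin
      rowPartial matrix a j
    ≡⟨ at-fun (+ 0) n a (λ a' → psum (λ b → atℤ n b (λ y → step a' (toℕ y))) j) a<n ⟩
      psum (λ b → atℤ n b (λ y → step a (toℕ y))) j
    ≡⟨ psum-cong _ _ j (λ b b<j → at-fun (+ 0) n b (step a) (ℕP.<-≤-trans b<j j≤n)) ⟩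
      psum (step a) j
    ≡⟨ psum-telescope (K.rowIncrement a) j ⟩
      K.rowIncrement a j - K.rowIncrement a 0
    ≡⟨ cong (λ v → K.rowIncrement a j - v) (K.rowIncrement-start a) ⟩
      K.rowIncrement a j - + 0
    ≡⟨ ℤP.+-identityʳ _ ⟩
      K.rowIncrement a j ∎
    where
      open ≡-Reasoning
      step : ℕ → ℕ → ℤ
      step a' k = K.rowIncrement a' (suc k) - K.rowIncrement a' k

  corner-matrix : ∀ i j → i ≤ n → j ≤ n → corner matrix i j ≡ K.cornerOf i j
  corner-matrix i j i≤n j≤n = trans (psum-cong _ _ i (λ a a<i → rowPartial-matrix a j (ℕP.<-≤-trans a<i i≤n) j≤n))
    (trans (psum-telescope (λ i → K.cornerOf i j) i) (ℤP.+-identityʳ _))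

  recovers : ∀ i j → proj₁ (toIsland asm) i j ≡ δ i j
  recovers i j = subst (λ v → v ∸ c ≡ δ i j) c+δ≡min (ℕP.m+n∸m≡n c (δ i j))
    where
      I J c : ℕ
      I = ix i
      J = ix j
      c = cornerCount matrix I J
      pad≡δ : K.pad I J ≡ δ i j
      pad≡δ = trans (at-toℕ 0 m i _) (at-toℕ 0 m j (δ i))
      c≡min-δ : + c ≡ + (I ⊓ J) - + δ i j
      c≡min-δ = trans (ASMProfile.count≡corner asm I J)
        (trans (corner-matrix I J (s≤s (ℕP.<⇒≤ (toℕ<n i))) (s≤s (ℕP.<⇒≤ (toℕ<n j))))
               (cong (λ v → + (I ⊓ J) - + v) pad≡δ))
      restore : ∀ x y → (x - y) + y ≡ x
      restore = solve-∀
      c+δ≡min : c ℕ.+ δ i j ≡ I ⊓ J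
      c+δ≡min = ℤP.+-injective (trans (ℤP.pos-+ c (δ i j))
        (trans (cong (_+ + δ i j) c≡min-δ) (restore (+ (I ⊓ J)) (+ δ i j))))

mainTheorem6 : (n : ℕ) → 2 ≤ n →
    Σ (ASM n → DyckIsland n) λ f →
      (∀ A → IsHalfHeightDiff n (proj₁ A) (proj₁ (f A)))
      × (∀ A B → (∀ i j → proj₁ (f A) i j ≡ proj₁ (f B) i j) →
                 ∀ a b → proj₁ A a b ≡ proj₁ B a b)
      × (∀ (D : DyckIsland n) → ∃ λ (A : ASM n) → ∀ i j → proj₁ (f A) i j ≡ proj₁ D i j)
mainTheorem6 (suc (suc k)) _ =
    toIsland
  , toIsland-height
  , (λ A B same → Injectivity.same-entries (suc k) A B same)
  , (λ D → FromIsland.asm (suc k) (proj₁ D) (proj₂ D) , FromIsland.recovers (suc k) (proj₁ D) (proj₂ D))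
mainTheorem6 (suc zero) (s≤s ())
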